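{- Let $\Lambda\neq\mathbb{N}_0$ be a symmetric numerical semigroup which is not hyperelliptic. Then $\Lambda$ is a leave of the semigroup tree, i.e. $\Lambda$ has no generator that is greater than or equal to its conductor.
   Context: A numerical semigroup is a subset $\Lambda\subseteq\mathbb{N}_0$ containing $0$, closed under addition, with finite complement; the gaps are the elements of $\mathbb{N}_0\setminus\Lambda$, the genus $g$ is the number of gaps, and the conductor $c$ is the smallest integer such that all integers $\geq c$ lie in $\Lambda$. Generators are the elements of the minimal generating set (nonzero elements not expressible as a sum of two nonzero elements of $\Lambda$). $\Lambda$ is symmetric if $c=2g$. $\Lambda$ is hyperelliptic if $\Lambda=\langle 2,2n+1\rangle$ (the semigroup generated by $2$ and $2n+1$) for some $n\geq 1$. In the semigroup tree, the children of $\Lambda$ are the semigroups $\Lambda\setminus\{x\}$ for $x$ a generator of $\Lambda$ with $x\geq c$; a leave is a node with no children. -}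

module Defs where

open import Data.Nat using (ℕ; zero; suc; _+_; _*_; _∸_; _≤_; _<_)
open import Data.Bool using (Bool; true; false; if_then_else_)
open import Data.Product using (Σ; ∃; ∃-syntax; _×_; _,_)
open import Data.Sum using (_⊎_)
open import Data.Empty using (⊥)
open import Relation.Nullary using (¬_)
open import Relation.Binary.PropositionalEquality using (_≡_; _≢_)

-- A subset of ℕ₀ given by its (decidable) membership function.
-- (Every numerical semigroup is decidable: its complement is finite.)
_∈_ : ℕ → (ℕ → Bool) → Set
n ∈ Λ = Λ n ≡ true

_∉_ : ℕ → (ℕ → Bool) → Set
n ∉ Λ = Λ n ≡ false

record IsNumericalSemigroup (Λ : ℕ → Bool) : Set where
  field
    zero-mem : 0 ∈ Λ
    add-closed : ∀ a b → a ∈ Λ → b ∈ Λ → (a + b) ∈ Λ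
    cofinite : ∃[ N ] (∀ n → N ≤ n → n ∈ Λ)

IsConductor : (ℕ → Bool) → ℕ → Set
IsConductor Λ c =
  (∀ n → c ≤ n → n ∈ Λ) × (∀ d → (∀ n → d ≤ n → n ∈ Λ) → c ≤ d)

gapsBelow : (ℕ → Bool) → ℕ → ℕ
gapsBelow Λ zero = 0
gapsBelow Λ (suc m) = (if Λ m then 0 else 1) + gapsBelow Λ m

-- g is the genus: the number of gaps (all gaps lie below the conductor c).
IsGenus : (ℕ → Bool) → ℕ → Set
IsGenus Λ g = ∃[ c ] (IsConductor Λ c × gapsBelow Λ c ≡ g)

Symmetric : (ℕ → Bool) → Set
Symmetric Λ = ∃[ c ] ∃[ g ] (IsConductor Λ c × IsGenus Λ g × c ≡ 2 * g)

In⟨2,_⟩ : ℕ → ℕ → Set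
In⟨2, m ⟩ x = ∃[ a ] ∃[ b ] (x ≡ 2 * a + m * b)

Hyperelliptic : (ℕ → Bool) → Set
Hyperelliptic Λ =
  ∃[ n ] (1 ≤ n × (∀ x → (x ∈ Λ → In⟨2, 2 * n + 1 ⟩ x) × (In⟨2, 2 * n + 1 ⟩ x → x ∈ Λ)))

IsGenerator : (ℕ → Bool) → ℕ → Set
IsGenerator Λ x =
  x ≢ 0 × x ∈ Λ ×
  ¬ (∃[ a ] ∃[ b ] (a ≢ 0 × b ≢ 0 × a ∈ Λ × b ∈ Λ × a + b ≡ x))

IsLeave : (ℕ → Bool) → Set
IsLeave Λ = ∀ c → IsConductor Λ c → ∀ x → IsGenerator Λ x → ¬ (c ≤ x)

-- In a symmetric semigroup with Frobenius number F = c - 1, exactly one of z and F - z is a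
-- gap for every z ≤ F: each such pair contains a gap, and there are only g = (F + 1) / 2 gaps.
-- Let m be the multiplicity. m = 1 is impossible and m = 2 forces Λ = ⟨2, F + 2⟩. For m ≥ 3,
-- a generator x > F makes x - m a gap, whose complement F - (x - m) is an element below m,
-- hence 0; so x = m + F. But m + F = a + (F - (a - m)) for any a ∈ Λ ∖ mℕ with a - m a gap,
-- and such an a is found by descending from F + 1 or F + 2 in steps of m.
module Submission where

open import Defs
open import Data.Nat
open import Data.Nat.Properties
open import Data.Nat.Divisibility using (_∣_; _∣?_; _∣0; ∣-refl; ∣m∣n⇒∣m+n; ∣m+n∣m⇒∣n; ∣1⇒≡1)
open import Data.Nat.Induction using (<-wellFounded)
open import Induction.WellFounded using (Acc; acc)
open import Data.Bool using (Bool; true; false; if_then_else_)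
open import Data.Bool.Properties using (¬-not; not-¬) renaming (_≟_ to _≟ᵇ_)
open import Data.Product using (∃-syntax; _×_; _,_; proj₁)
open import Data.Sum using (_⊎_; inj₁; inj₂)
open import Function using (_∘_)
open import Relation.Nullary using (¬_; yes; no; contradiction)
open import Relation.Unary using (Decidable)
open import Relation.Binary.PropositionalEquality
open import Algebra.Properties.CommutativeSemigroup +-commutativeSemigroup using (interchange)
open import Data.Nat.Tactic.RingSolver using (solve-∀)

sumBelow : ℕ → (ℕ → ℕ) → ℕ
sumBelow zero    f = 0
sumBelow (suc k) f = f 0 + sumBelow k (f ∘ suc)

sumBelow-suc : ∀ k f → sumBelow (suc k) f ≡ sumBelow k f + f k
sumBelow-suc zero    f = +-identityʳ (f 0)
sumBelow-suc (suc k) f = begin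
  f 0 + sumBelow (suc k) (f ∘ suc)         ≡⟨ cong (f 0 +_) (sumBelow-suc k (f ∘ suc)) ⟩
  f 0 + (sumBelow k (f ∘ suc) + f (suc k)) ≡⟨ +-assoc (f 0) _ _ ⟨
  sumBelow (suc k) f + f (suc k)           ∎
  where open ≡-Reasoning

sumBelow-+ : ∀ k f h → sumBelow k (λ z → f z + h z) ≡ sumBelow k f + sumBelow k h
sumBelow-+ zero    f h = refl
sumBelow-+ (suc k) f h = begin
  f 0 + h 0 + sumBelow k (λ z → f (suc z) + h (suc z))
    ≡⟨ cong (f 0 + h 0 +_) (sumBelow-+ k (f ∘ suc) (h ∘ suc)) ⟩
  f 0 + h 0 + (sumBelow k (f ∘ suc) + sumBelow k (h ∘ suc))
    ≡⟨ interchange (f 0) (h 0) _ _ ⟩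
  f 0 + sumBelow k (f ∘ suc) + (h 0 + sumBelow k (h ∘ suc)) ∎
  where open ≡-Reasoning

sumBelow-reverse : ∀ k f → sumBelow (suc k) (λ z → f (k ∸ z)) ≡ sumBelow (suc k) f
sumBelow-reverse zero    f = refl
sumBelow-reverse (suc k) f = begin
  f (suc k) + sumBelow (suc k) (λ z → f (k ∸ z)) ≡⟨ cong (f (suc k) +_) (sumBelow-reverse k f) ⟩
  f (suc k) + sumBelow (suc k) f                 ≡⟨ +-comm (f (suc k)) _ ⟩
  sumBelow (suc k) f + f (suc k)                 ≡⟨ sumBelow-suc (suc k) f ⟨
  sumBelow (suc (suc k)) f                       ∎
  where open ≡-Reasoning

sumBelow-ones : ∀ k → sumBelow k (λ _ → 1) ≡ k
sumBelow-ones zero    = refl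
sumBelow-ones (suc k) = cong suc (sumBelow-ones k)

sumBelow-mono-≤ : ∀ k {f h} → (∀ z → z < k → f z ≤ h z) → sumBelow k f ≤ sumBelow k h
sumBelow-mono-≤ zero    f≤h = z≤n
sumBelow-mono-≤ (suc k) f≤h =
  +-mono-≤ (f≤h 0 z<s) (sumBelow-mono-≤ k (λ z z<k → f≤h (suc z) (s<s z<k)))

sumBelow-mono-< : ∀ k {f h} → (∀ z → z < k → f z ≤ h z) →
                  ∀ z → z < k → f z < h z → sumBelow k f < sumBelow k h
sumBelow-mono-< (suc k) f≤h zero    _         f0<h0 =
  +-mono-<-≤ f0<h0 (sumBelow-mono-≤ k (λ z z<k → f≤h (suc z) (s<s z<k)))
sumBelow-mono-< (suc k) f≤h (suc z) (s<s z<k) fz<hz =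
  +-mono-≤-< (f≤h 0 z<s) (sumBelow-mono-< k (λ z z<k → f≤h (suc z) (s<s z<k)) z z<k fz<hz)

gapIndicator : (ℕ → Bool) → ℕ → ℕ
gapIndicator Λ z = if Λ z then 0 else 1

gapsBelow≡sumBelow : ∀ Λ k → gapsBelow Λ k ≡ sumBelow k (gapIndicator Λ)
gapsBelow≡sumBelow Λ zero    = refl
gapsBelow≡sumBelow Λ (suc k) = begin
  gapIndicator Λ k + gapsBelow Λ k               ≡⟨ cong (gapIndicator Λ k +_) (gapsBelow≡sumBelow Λ k) ⟩
  gapIndicator Λ k + sumBelow k (gapIndicator Λ) ≡⟨ +-comm (gapIndicator Λ k) _ ⟩
  sumBelow k (gapIndicator Λ) + gapIndicator Λ k ≡⟨ sumBelow-suc k (gapIndicator Λ) ⟨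
  sumBelow (suc k) (gapIndicator Λ)              ∎
  where open ≡-Reasoning

gap-complement : ∀ {Λ F} → (∀ a b → a ∈ Λ → b ∈ Λ → (a + b) ∈ Λ) → F ∉ Λ →
                 suc F ≡ 2 * gapsBelow Λ (suc F) →
                 ∀ {z w} → z + w ≡ F → z ∉ Λ → w ∈ Λ
gap-complement {Λ} {F} add-closed F∉Λ F+1≡2g {z} {w} z+w≡F z∉Λ = ¬-not ¬w∉Λ
  where
  gapsInPair : ℕ → ℕ
  gapsInPair y = gapIndicator Λ y + gapIndicator Λ (F ∸ y)

  pair-has-gap : ∀ y → y < suc F → 1 ≤ gapsInPair y
  pair-has-gap y y<F+1 with Λ y in y∈? | Λ (F ∸ y) in Fy∈?
  ... | false | _     = s≤s z≤n
  ... | true  | false = s≤s z≤n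
  ... | true  | true  =
    contradiction (subst (_∈ Λ) (m+[n∸m]≡n (≤-pred y<F+1)) (add-closed y (F ∸ y) y∈? Fy∈?))
                  (not-¬ F∉Λ)

  gapsInPairs : sumBelow (suc F) gapsInPair ≡ suc F
  gapsInPairs = begin
    sumBelow (suc F) gapsInPair
      ≡⟨ sumBelow-+ (suc F) (gapIndicator Λ) (gapIndicator Λ ∘ (F ∸_)) ⟩
    sumBelow (suc F) (gapIndicator Λ) + sumBelow (suc F) (gapIndicator Λ ∘ (F ∸_))
      ≡⟨ cong (sumBelow (suc F) (gapIndicator Λ) +_) (sumBelow-reverse F (gapIndicator Λ)) ⟩
    sumBelow (suc F) (gapIndicator Λ) + sumBelow (suc F) (gapIndicator Λ)
      ≡⟨ cong (λ n → n + n) (gapsBelow≡sumBelow Λ (suc F)) ⟨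
    gapsBelow Λ (suc F) + gapsBelow Λ (suc F)
      ≡⟨ cong (gapsBelow Λ (suc F) +_) (+-identityʳ _) ⟨
    2 * gapsBelow Λ (suc F)
      ≡⟨ F+1≡2g ⟨
    suc F ∎
    where open ≡-Reasoning

  ¬w∉Λ : ¬ (w ∉ Λ)
  ¬w∉Λ w∉Λ = <-irrefl refl (begin-strict
    suc F                           ≡⟨ sumBelow-ones (suc F) ⟨
    sumBelow (suc F) (λ _ → 1)      <⟨ sumBelow-mono-< (suc F) pair-has-gap z z<F+1 two-gaps ⟩
    sumBelow (suc F) gapsInPair     ≡⟨ gapsInPairs ⟩
    suc F                           ∎)
    where
    open ≤-Reasoning
    z<F+1 : z < suc F
    z<F+1 = s≤s (subst (z ≤_) z+w≡F (m≤m+n z w))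
    F∸z≡w : F ∸ z ≡ w
    F∸z≡w = trans (cong (_∸ z) (sym z+w≡F)) (m+n∸m≡n z w)
    two-gaps : 1 < gapsInPair z
    two-gaps rewrite z∉Λ | F∸z≡w | w∉Λ = ≤-refl

module _ {P : ℕ → Set} (P? : Decidable P) where

  private
    search : ∀ n → (∀ {j} → j < n → ¬ P j) ⊎ ∃[ k ] (P k × ∀ {j} → j < k → ¬ P j)
    search zero    = inj₁ λ ()
    search (suc n) with search n
    ... | inj₂ least = inj₂ least
    ... | inj₁ none<n with P? n
    ...   | yes Pn = inj₂ (n , Pn , none<n)
    ...   | no ¬Pn = inj₁ none<n+1
      where
      none<n+1 : ∀ {j} → j < suc n → ¬ P j
      none<n+1 j<n+1 with m<1+n⇒m<n∨m≡n j<n+1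
      ... | inj₁ j<n  = none<n j<n
      ... | inj₂ refl = ¬Pn

  minimal : ∀ {n} → P n → ∃[ k ] (P k × ∀ {j} → j < k → ¬ P j)
  minimal {n} Pn with search (suc n)
  ... | inj₁ none  = contradiction Pn (none ≤-refl)
  ... | inj₂ least = least

conductor-unique : ∀ {Λ a b} → IsConductor Λ a → IsConductor Λ b → a ≡ b
conductor-unique (a-up , a-least) (b-up , b-least) = ≤-antisym (a-least _ b-up) (b-least _ a-up)

conductor-pred∉ : ∀ {Λ F} → IsConductor Λ (suc F) → F ∉ Λ
conductor-pred∉ {Λ} {F} (up , least) = ¬-not λ F∈Λ → 1+n≰n (least F (from-F F∈Λ))
  where
  from-F : F ∈ Λ → ∀ n → F ≤ n → n ∈ Λ
  from-F F∈Λ n F≤n with m≤n⇒m<n∨m≡n F≤n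
  ... | inj₁ F<n  = up n F<n
  ... | inj₂ refl = F∈Λ

Decomposable : (ℕ → Bool) → ℕ → Set
Decomposable Λ x = ∃[ a ] ∃[ b ] (a ≢ 0 × b ≢ 0 × a ∈ Λ × b ∈ Λ × a + b ≡ x)

indecomposable⇒summand∉ : ∀ {Λ x a b} → ¬ Decomposable Λ x →
                          a ≢ 0 → b ≢ 0 → a ∈ Λ → a + b ≡ x → b ∉ Λ
indecomposable⇒summand∉ ¬dec a≢0 b≢0 a∈Λ a+b≡x =
  ¬-not λ b∈Λ → ¬dec (_ , _ , a≢0 , b≢0 , a∈Λ , b∈Λ , a+b≡x)

even-or-odd : ∀ n → ∃[ q ] (n ≡ 2 * q ⊎ n ≡ 1 + 2 * q)
even-or-odd zero    = 0 , inj₁ refl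
even-or-odd (suc n) with even-or-odd n
... | q , inj₁ refl = q , inj₂ refl
... | q , inj₂ refl = suc q , inj₁ (cong suc (sym (+-suc q (q + 0))))

module _ {Λ : ℕ → Bool} (ns : IsNumericalSemigroup Λ) where
  open IsNumericalSemigroup ns

  multiple∈ : ∀ k {a} → a ∈ Λ → (k * a) ∈ Λ
  multiple∈ zero    a∈Λ = zero-mem
  multiple∈ (suc k) a∈Λ = add-closed _ _ a∈Λ (multiple∈ k a∈Λ)

  even∈ : 2 ∈ Λ → ∀ p → (2 * p) ∈ Λ
  even∈ 2∈Λ p = subst (_∈ Λ) (*-comm p 2) (multiple∈ p 2∈Λ)

  module _ {F : ℕ} (F∉Λ : F ∉ Λ) (above-F : ∀ {n} → F < n → n ∈ Λ) where

    gap⇒≤Frobenius : ∀ {n} → n ∉ Λ → n ≤ F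
    gap⇒≤Frobenius n∉Λ = ≮⇒≥ λ F<n → not-¬ (above-F F<n) n∉Λ

    multiplicity : ∃[ m ] (m ≢ 0 × m ∈ Λ × ∀ {y} → y ≢ 0 → y < m → y ∉ Λ)
    multiplicity with minimal (λ k → Λ (suc k) ≟ᵇ true) {F} (above-F ≤-refl)
    ... | k , k+1∈Λ , none<k = suc k , (λ ()) , k+1∈Λ , below
      where
      below : ∀ {y} → y ≢ 0 → y < suc k → y ∉ Λ
      below {zero}  y≢0 _         = contradiction refl y≢0
      below {suc j} _   (s<s j<k) = ¬-not (none<k j<k)

    two∈⇒hyperelliptic : 2 ∈ Λ → Hyperelliptic Λ
    two∈⇒hyperelliptic 2∈Λ with even-or-odd F
    ... | q , inj₁ refl = contradiction (even∈ 2∈Λ q) (not-¬ F∉Λ)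
    ... | q , inj₂ refl = suc q , s≤s z≤n , λ x → ∈⇒generated x , generated⇒∈ x
      where
      M : ℕ
      M = 2 * suc q + 1

      odd∈⇒>Frobenius : ∀ p → (1 + 2 * p) ∈ Λ → q < p
      odd∈⇒>Frobenius p odd∈Λ = ≰⇒> λ p≤q → not-¬ (odd+even∈ p≤q) F∉Λ
        where
        odd+even∈ : p ≤ q → (1 + 2 * q) ∈ Λ
        odd+even∈ p≤q with m≤n⇒∃[o]m+o≡n p≤q
        ... | r , refl = subst (_∈ Λ) (split p r) (add-closed _ _ odd∈Λ (even∈ 2∈Λ r))
          where
          split : ∀ p r → 1 + 2 * p + 2 * r ≡ 1 + 2 * (p + r)
          split = solve-∀

      ∈⇒generated : ∀ x → x ∈ Λ → In⟨2, M ⟩ x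
      ∈⇒generated x x∈Λ with even-or-odd x
      ... | p , inj₁ refl = p , 0 , even p q
        where
        even : ∀ p q → 2 * p ≡ 2 * p + (2 * suc q + 1) * 0
        even = solve-∀
      ... | p , inj₂ refl with m≤n⇒∃[o]m+o≡n (odd∈⇒>Frobenius p x∈Λ)
      ...   | r , refl = r , 1 , odd q r
        where
        odd : ∀ q r → 1 + 2 * (suc q + r) ≡ 2 * r + (2 * suc q + 1) * 1
        odd = solve-∀

      M∈Λ : M ∈ Λ
      M∈Λ = above-F (≤-trans (n≤1+n _) (≤-reflexive (M≡F+2 q)))
        where
        M≡F+2 : ∀ q → 2 + (1 + 2 * q) ≡ 2 * suc q + 1
        M≡F+2 = solve-∀

      generated⇒∈ : ∀ x → In⟨2, M ⟩ x → x ∈ Λ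
      generated⇒∈ x (a , b , refl) =
        add-closed _ _ (even∈ 2∈Λ a) (subst (_∈ Λ) (*-comm b M) (multiple∈ b M∈Λ))

    module _ (symmetry : ∀ {z w} → z + w ≡ F → z ∉ Λ → w ∈ Λ) where

      module _ {m : ℕ} (m∈Λ : m ∈ Λ) (3≤m : 3 ≤ m)
               (below-m∉ : ∀ {y} → y ≢ 0 → y < m → y ∉ Λ) where

        m≤element : ∀ {y} → y ≢ 0 → y ∈ Λ → m ≤ y
        m≤element y≢0 y∈Λ = ≮⇒≥ λ y<m → not-¬ y∈Λ (below-m∉ y≢0 y<m)

        element<m⇒≡0 : ∀ {y} → y ∈ Λ → y < m → y ≡ 0
        element<m⇒≡0 {zero}  _   _   = refl
        element<m⇒≡0 {suc y} y∈Λ y<m = contradiction y∈Λ (not-¬ (below-m∉ (λ ()) y<m))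

        m≢0 : m ≢ 0
        m≢0 = m<n⇒n≢0 3≤m

        1∉Λ : 1 ∉ Λ
        1∉Λ = below-m∉ (λ ()) (≤-trans (s≤s (s≤s z≤n)) 3≤m)

        multiplicity<Frobenius : m < F
        multiplicity<Frobenius with m≤n⇒∃[o]m+o≡n (gap⇒≤Frobenius 1∉Λ)
        ... | zero  , 1≡F   = contradiction (above-F (≤-reflexive (cong suc (sym 1≡F))))
                                            (not-¬ (below-m∉ (λ ()) 3≤m))
        ... | suc w , 1+w≡F = subst (m <_) 1+w≡F (s≤s (m≤element (λ ()) (symmetry 1+w≡F 1∉Λ)))

        generator-above-Frobenius : ∀ {x} → F < x → IsGenerator Λ x → x ≡ m + F
        generator-above-Frobenius {x} F<x (_ , _ , ¬dec)
          with m≤n⇒∃[o]m+o≡n (<-trans multiplicity<Frobenius F<x)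
        ... | o , m+1+o≡x = begin
          x           ≡⟨ m+y≡x ⟨
          m + y       ≡⟨ cong (m +_) y≡F ⟩
          m + F       ∎
          where
          open ≡-Reasoning
          y : ℕ
          y = suc o
          m+y≡x : m + y ≡ x
          m+y≡x = trans (+-suc m o) m+1+o≡x
          y∉Λ : y ∉ Λ
          y∉Λ = indecomposable⇒summand∉ ¬dec m≢0 (λ ()) m∈Λ m+y≡x
          y≡F : y ≡ F
          y≡F with m≤n⇒∃[o]m+o≡n (gap⇒≤Frobenius y∉Λ)
          ... | w , y+w≡F = begin
            y     ≡⟨ +-identityʳ y ⟨
            y + 0 ≡⟨ cong (y +_) (element<m⇒≡0 (symmetry y+w≡F y∉Λ) w<m) ⟨
            y + w ≡⟨ y+w≡F ⟩
            F     ∎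
            where
            w<m : w < m
            w<m = +-cancelˡ-< y w m (subst₂ _<_ (sym y+w≡F) (trans (sym m+y≡x) (+-comm m y)) F<x)

        decomposable-by-descent : ∀ {a} → Acc _<_ a → a ∈ Λ → ¬ m ∣ a → a ≤ 2 + F →
                                  Decomposable Λ (m + F)
        decomposable-by-descent {a} (acc rec) a∈Λ m∤a a≤F+2
          with m≤n⇒∃[o]m+o≡n (m≤element (λ { refl → m∤a (m ∣0) }) a∈Λ)
        ... | r , refl with Λ r in r∈?
        ...   | true  = decomposable-by-descent (rec (m<n+m r (m<n⇒0<n 3≤m))) r∈?
                          (m∤a ∘ ∣m∣n⇒∣m+n ∣-refl) (≤-trans (m≤n+m r m) a≤F+2)
        ...   | false with m≤n⇒∃[o]m+o≡n (≤-pred (≤-pred (≤-trans (+-monoˡ-≤ r 3≤m) a≤F+2)))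
        ...     | o , r+1+o≡F =
          m + r , suc o , m+r≢0 , (λ ()) , a∈Λ , symmetry r+b≡F r∈? , a+b≡m+F
          where
          m+r≢0 : m + r ≢ 0
          m+r≢0 = m≢0 ∘ m+n≡0⇒m≡0 m
          r+b≡F : r + suc o ≡ F
          r+b≡F = trans (+-suc r o) r+1+o≡F
          a+b≡m+F : m + r + suc o ≡ m + F
          a+b≡m+F = trans (+-assoc m r (suc o)) (cong (m +_) r+b≡F)

        multiplicity+Frobenius-decomposable : Decomposable Λ (m + F)
        multiplicity+Frobenius-decomposable with m ∣? suc F
        ... | no  m∤F+1 =
          decomposable-by-descent (<-wellFounded _) (above-F ≤-refl) m∤F+1 (n≤1+n _)
        ... | yes m∣F+1 =
          decomposable-by-descent (<-wellFounded _) (above-F (n≤1+n _)) m∤F+2 ≤-refl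
          where
          m∤F+2 : ¬ m ∣ 2 + F
          m∤F+2 m∣F+2 = <-irrefl (sym (∣1⇒≡1 m∣1)) (≤-trans (s≤s (s≤s z≤n)) 3≤m)
            where
            m∣1 : m ∣ 1
            m∣1 = ∣m+n∣m⇒∣n (subst (m ∣_) (+-comm 1 (suc F)) m∣F+2) m∣F+1

        no-generator-above-Frobenius : ∀ {x} → F < x → ¬ IsGenerator Λ x
        no-generator-above-Frobenius F<x gen@(_ , _ , ¬dec) =
          ¬dec (subst (Decomposable Λ) (sym (generator-above-Frobenius F<x gen))
                      multiplicity+Frobenius-decomposable)

      non-hyperelliptic⇒no-generator-above-Frobenius :
        ¬ Hyperelliptic Λ → ∀ {x} → F < x → ¬ IsGenerator Λ x
      non-hyperelliptic⇒no-generator-above-Frobenius ¬hyp with multiplicity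
      ... | 0 , m≢0 , _     = contradiction refl m≢0
      ... | 1 , _ , 1∈Λ , _ = contradiction (subst (_∈ Λ) (*-identityʳ F) (multiple∈ F 1∈Λ)) (not-¬ F∉Λ)
      ... | 2 , _ , 2∈Λ , _ = contradiction (two∈⇒hyperelliptic 2∈Λ) ¬hyp
      ... | suc (suc (suc _)) , _ , m∈Λ , below-m∉ =
        no-generator-above-Frobenius m∈Λ (s≤s (s≤s (s≤s z≤n))) below-m∉

mainTheorem2 : (Λ : ℕ → Bool) → IsNumericalSemigroup Λ →
    (∃[ n ] (n ∉ Λ)) → Symmetric Λ → ¬ Hyperelliptic Λ → IsLeave Λ
mainTheorem2 Λ _ (n , n∉Λ) (zero , _ , (all∈Λ , _) , _) _ _ _ _ _ _ =
  contradiction (all∈Λ n z≤n) (not-¬ n∉Λ)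
mainTheorem2 Λ ns _ (suc F , g , conductor , (_ , conductor′ , gapsBelow≡g) , F+1≡2g) ¬hyp
             _ conductor″ x gen c″≤x =
  non-hyperelliptic⇒no-generator-above-Frobenius ns F∉Λ (proj₁ conductor _) symmetry ¬hyp F<x gen
  where
  F∉Λ : F ∉ Λ
  F∉Λ = conductor-pred∉ conductor
  genus : gapsBelow Λ (suc F) ≡ g
  genus = subst (λ c → gapsBelow Λ c ≡ g) (conductor-unique conductor′ conductor) gapsBelow≡g
  symmetry : ∀ {z w} → z + w ≡ F → z ∉ Λ → w ∈ Λ
  symmetry = gap-complement (IsNumericalSemigroup.add-closed ns) F∉Λ
                            (trans F+1≡2g (cong (2 *_) (sym genus)))
  F<x : F < x
  F<x = subst (_≤ x) (conductor-unique conductor″ conductor) c″≤x
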